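{- Let \(\beta:B\to D\) be a small compact basis for a \(\mathcal V\)-dcpo \(D\) and let \(x:D\) be compact. Then there exists \(b:B\) such that \(\beta(b)=x\).
   Context: We work constructively and predicatively in univalent foundations with universes and propositional truncation; "there exists" is truncated existence. \(\mathcal V\)-small: equivalent to a type in \(\mathcal V\). Directed family: inhabited index and any two indices have (there exists) a common upper index. \(\mathcal V\)-dcpo: poset with suprema of directed families indexed by types in \(\mathcal V\). Way-below: \(x\ll y\) iff for every directed \(\alpha:I\to D\), \(I:\mathcal V\), with \(y\sqsubseteq\bigsqcup\alpha\) there exists \(i\) with \(x\sqsubseteq\alpha_i\); \(x\) is compact if \(x\ll x\). Small compact basis: a map \(\beta:B\to D\) with \(B:\mathcal V\) such that each \(\beta(b)\) is compact, for every \(x:D\) the family \(\Sigma_{b:B}(\beta(b)\sqsubseteq x)\to D\), \((b,-)\mapsto\beta(b)\), is directed with supremum \(x\), and each proposition \(\beta(b)\sqsubseteq x\) is \(\mathcal V\)-small. -}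

module Defs where

open import Level using (Level; _⊔_; Setω) renaming (suc to lsuc)
open import Data.Product using (Σ; _×_; _,_; proj₁; proj₂)
open import Relation.Binary.PropositionalEquality using (_≡_)
open import Function.Bundles using (_↔_)

isProp : ∀ {ℓ} → Set ℓ → Set ℓ
isProp A = (a b : A) → a ≡ b

isSet : ∀ {ℓ} → Set ℓ → Set ℓ
isSet A = (a b : A) → isProp (a ≡ b)

is-small : ∀ {ℓ} (𝓥 : Level) → Set ℓ → Set (lsuc 𝓥 ⊔ ℓ)
is-small 𝓥 A = Σ (Set 𝓥) (λ A' → A' ↔ A)

record PropTrunc : Setω where
  field
    ∥_∥       : ∀ {ℓ} → Set ℓ → Set ℓ
    ∥∥-isProp : ∀ {ℓ} {A : Set ℓ} → isProp ∥ A ∥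
    ∣_∣       : ∀ {ℓ} {A : Set ℓ} → A → ∥ A ∥
    ∥∥-rec    : ∀ {ℓ ℓ'} {A : Set ℓ} {P : Set ℓ'} → isProp P → (A → P) → ∥ A ∥ → P

module WithTrunc (pt : PropTrunc) where
  open PropTrunc pt

  ∃∥ : ∀ {ℓ ℓ'} (A : Set ℓ) (P : A → Set ℓ') → Set (ℓ ⊔ ℓ')
  ∃∥ A P = ∥ Σ A P ∥

  is-directed : ∀ {𝓤 𝓣 𝓘} {D : Set 𝓤} (_⊑_ : D → D → Set 𝓣)
                {I : Set 𝓘} (α : I → D) → Set (𝓣 ⊔ 𝓘)
  is-directed _⊑_ {I} α =
    ∥ I ∥ × ((i j : I) → ∃∥ I (λ k → (α i ⊑ α k) × (α j ⊑ α k)))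

  is-sup : ∀ {𝓤 𝓣 𝓘} {D : Set 𝓤} (_⊑_ : D → D → Set 𝓣)
           (x : D) {I : Set 𝓘} (α : I → D) → Set (𝓤 ⊔ 𝓣 ⊔ 𝓘)
  is-sup {D = D} _⊑_ x {I} α =
    ((i : I) → α i ⊑ x) × ((y : D) → ((i : I) → α i ⊑ y) → x ⊑ y)

  record DCPO (𝓥 𝓤 𝓣 : Level) : Set (lsuc 𝓥 ⊔ lsuc 𝓤 ⊔ lsuc 𝓣) where
    field
      ⟨_⟩        : Set 𝓤
      _⊑_        : ⟨_⟩ → ⟨_⟩ → Set 𝓣
      carrier-set : isSet ⟨_⟩
      ⊑-prop     : (x y : ⟨_⟩) → isProp (x ⊑ y)
      ⊑-refl     : (x : ⟨_⟩) → x ⊑ x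
      ⊑-trans    : (x y z : ⟨_⟩) → x ⊑ y → y ⊑ z → x ⊑ z
      ⊑-antisym  : (x y : ⟨_⟩) → x ⊑ y → y ⊑ x → x ≡ y
      ∐          : {I : Set 𝓥} (α : I → ⟨_⟩) → is-directed _⊑_ α → ⟨_⟩
      ∐-is-sup   : {I : Set 𝓥} (α : I → ⟨_⟩) (δ : is-directed _⊑_ α)
                   → is-sup _⊑_ (∐ α δ) α

  module _ {𝓥 𝓤 𝓣 : Level} (D : DCPO 𝓥 𝓤 𝓣) where
    open DCPO D

    way-below : ⟨_⟩ → ⟨_⟩ → Set (lsuc 𝓥 ⊔ 𝓤 ⊔ 𝓣)
    way-below x y = {I : Set 𝓥} (α : I → ⟨_⟩) (δ : is-directed _⊑_ α)
                    → y ⊑ ∐ α δ → ∃∥ I (λ i → x ⊑ α i)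

    is-compact : ⟨_⟩ → Set (lsuc 𝓥 ⊔ 𝓤 ⊔ 𝓣)
    is-compact x = way-below x x

    ↓ᴮ : {B : Set 𝓥} (β : B → ⟨_⟩) (x : ⟨_⟩) → Σ B (λ b → β b ⊑ x) → ⟨_⟩
    ↓ᴮ β x (b , _) = β b

    is-small-compact-basis : {B : Set 𝓥} (β : B → ⟨_⟩) → Set (lsuc 𝓥 ⊔ 𝓤 ⊔ 𝓣)
    is-small-compact-basis {B} β =
        ((b : B) → is-compact (β b))
      × ((x : ⟨_⟩) → is-directed _⊑_ (↓ᴮ β x) × is-sup _⊑_ x (↓ᴮ β x))
      × ((b : B) (x : ⟨_⟩) → is-small 𝓥 (β b ⊑ x))

module Submission where

-- A compact x is the supremum of the directed family of basis elements below it;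
-- since β b ⊑ x is small, that family can be reindexed by a type in 𝓥, so
-- compactness puts x below, hence equal to, one of its members.

open import Defs
open import Level using (Level)
open import Relation.Binary.PropositionalEquality using (_≡_; subst; sym)
open import Data.Product using (Σ; _,_; proj₁; proj₂)
open import Data.Product.Function.Dependent.Propositional using (Σ-↠)
open import Function using (_∘_)
open import Function.Bundles using (_↠_; Surjection)
open import Function.Construct.Identity using (↠-id)
open import Function.Properties.Inverse using (↔⇒↠)

module DCPOProperties (pt : PropTrunc) where
  open PropTrunc pt
  open WithTrunc pt

  ∥∥-map : ∀ {ℓ ℓ'} {A : Set ℓ} {A' : Set ℓ'} → (A → A') → ∥ A ∥ → ∥ A' ∥
  ∥∥-map f = ∥∥-rec ∥∥-isProp (∣_∣ ∘ f)

  module _ {𝓥 𝓤 𝓣 : Level} (D : DCPO 𝓥 𝓤 𝓣) where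
    open DCPO D

    module _ {𝓘 𝓙} {I : Set 𝓘} {J : Set 𝓙} (e : J ↠ I) (α : I → ⟨_⟩) where
      open Surjection e using (to; to⁻; to∘to⁻)

      ⊑-at-to∘to⁻ : ∀ {y} i → y ⊑ α i → y ⊑ α (to (to⁻ i))
      ⊑-at-to∘to⁻ {y} i = subst (λ k → y ⊑ α k) (sym (to∘to⁻ i))

      ⊒-at-to∘to⁻ : ∀ {y} i → α (to (to⁻ i)) ⊑ y → α i ⊑ y
      ⊒-at-to∘to⁻ {y} i = subst (λ k → α k ⊑ y) (to∘to⁻ i)

      reindex-directed : is-directed _⊑_ α → is-directed _⊑_ (α ∘ to)
      reindex-directed (inhabited , semidirected) =
          ∥∥-map to⁻ inhabited
        , λ j j' → ∥∥-map
            (λ (k , u , v) → to⁻ k , ⊑-at-to∘to⁻ k u , ⊑-at-to∘to⁻ k v)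
            (semidirected (to j) (to j'))

      reindex-sup : ∀ {x} → is-sup _⊑_ x α → is-sup _⊑_ x (α ∘ to)
      reindex-sup (upper , least) =
          upper ∘ to
        , λ y y-upper → least y (λ i → ⊒-at-to∘to⁻ i (y-upper (to⁻ i)))

    -- x ⊑ ∐ α as x is the least upper bound, so compactness puts x below some α i.
    compact-sup-is-attained : {I : Set 𝓥} (α : I → ⟨_⟩) → is-directed _⊑_ α
      → ∀ {x} → is-sup _⊑_ x α → is-compact D x → ∃∥ I (λ i → α i ≡ x)
    compact-sup-is-attained α δ {x} (x-upper , x-least) x-compact =
      ∥∥-map (λ (i , x⊑αi) → i , ⊑-antisym (α i) x (x-upper i) x⊑αi)
        (x-compact α δ (x-least (∐ α δ) (proj₁ (∐-is-sup α δ))))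

proposition5p16 : (pt : PropTrunc) → let open WithTrunc pt in
    {𝓥 𝓤 𝓣 : Level} (D : DCPO 𝓥 𝓤 𝓣) {B : Set 𝓥} (β : B → DCPO.⟨_⟩ D)
    → is-small-compact-basis D β
    → (x : DCPO.⟨_⟩ D) → is-compact D x
    → ∃∥ B (λ b → β b ≡ x)
proposition5p16 pt D β (_ , ↓ᴮ-directed-sup , ↓ᴮ-small) x x-compact =
  ∥∥-map (λ (j , βb≡x) → proj₁ (to j) , βb≡x)
    (compact-sup-is-attained D (↓ᴮ D β x ∘ to)
      (reindex-directed D ↓ᴮ-resizing (↓ᴮ D β x) (proj₁ (↓ᴮ-directed-sup x)))
      (reindex-sup D ↓ᴮ-resizing (↓ᴮ D β x) (proj₂ (↓ᴮ-directed-sup x)))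
      x-compact)
  where
  open WithTrunc pt
  open DCPOProperties pt
  open DCPO D using (_⊑_)
  ↓ᴮ-resizing : Σ _ (λ b → proj₁ (↓ᴮ-small b x)) ↠ Σ _ (λ b → β b ⊑ x)
  ↓ᴮ-resizing = Σ-↠ (↠-id _) (↔⇒↠ (proj₂ (↓ᴮ-small _ x)))
  open Surjection ↓ᴮ-resizing using (to)
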